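{- There exist infinitely many Lucas pairs $(\alpha,\beta)$, none of which is of the form $(\alpha,1)$ with $\alpha \ge 2$ a rational integer, such that for each of these pairs there exist infinitely many positive integers $k$ for which \[k\left(U_n(\alpha,\beta) + (\alpha-\beta)^2\right) + 1\] is composite for all integers $n \ge 1$.
   Context: A Lucas pair is a pair $(\alpha,\beta)$ of algebraic integers such that $\alpha+\beta$ and $\alpha\beta$ are nonzero relatively prime rational integers and $\alpha/\beta$ is not a root of unity. For a Lucas pair, $U_n(\alpha,\beta) = \frac{\alpha^n-\beta^n}{\alpha-\beta}$ for $n \ge 0$ (a sequence of rational integers); $(\alpha-\beta)^2$ is also a rational integer. -}

module Defs where

open import Data.Nat as ℕ using (ℕ; zero; suc)
open import Data.Nat.Primality using (Composite)
open import Data.Integer using (ℤ; +_; _+_; _-_; _*_)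
open import Data.Integer.GCD using (gcd)
open import Data.Product using (Σ; _×_; ∃-syntax)
open import Relation.Binary.PropositionalEquality using (_≡_; _≢_)
open import Relation.Nullary using (¬_)

-- A Lucas pair (α, β) is determined (up to the order of α, β) by the rational
-- integers P = α + β and Q = α β: α, β are the two roots of x² - P x + Q.

-- U_n(α,β) = (αⁿ - βⁿ)/(α - β), via the standard recurrence
-- U₀ = 0, U₁ = 1, U_{n+2} = P U_{n+1} - Q U_n (which is what the closed form satisfies).
U : ℤ → ℤ → ℕ → ℤ
U P Q zero = + 0
U P Q (suc zero) = + 1
U P Q (suc (suc n)) = P * U P Q (suc n) - Q * U P Q n

-- (α - β)² = (α + β)² - 4 α β
Disc : ℤ → ℤ → ℤ
Disc P Q = P * P - + 4 * Q

-- α/β is a root of unity  ⇔  αᵐ = βᵐ for some m ≥ 1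
--                          ⇔  (αᵐ - βᵐ)² = 0 for some m ≥ 1,
-- and (αᵐ - βᵐ)² = (α - β)² · U_m² is the rational integer Disc·U_m².
RatioRootOfUnity : ℤ → ℤ → Set
RatioRootOfUnity P Q = ∃[ m ] (1 ℕ.≤ m × Disc P Q * (U P Q m * U P Q m) ≡ + 0)

IsLucasPair : ℤ → ℤ → Set
IsLucasPair P Q = P ≢ + 0 × Q ≢ + 0 × gcd P Q ≡ + 1 × ¬ RatioRootOfUnity P Q

-- The pair is of the form (a, 1) (or (1, a)) with a ≥ 2 a rational integer,
-- i.e. P = a + 1 and Q = a.
IsTrivialForm : ℤ → ℤ → Set
IsTrivialForm P Q = ∃[ a ] (2 ℕ.≤ a × P ≡ + a + + 1 × Q ≡ + a)

IsComposite : ℤ → Set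
IsComposite z = ∃[ m ] (z ≡ + m × Composite m)

{-# OPTIONS --safe #-}
-- Take P = 1 + 3N and Q = -3. Since P > 0 > Q, both U_n (n ≥ 1) and (α - β)² are positive,
-- so α/β is not a root of unity; and U_{n+2} = P U_{n+1} + 3 U_n ≡ U_{n+1} (mod 3) gives
-- U_n ≡ 1 for n ≥ 1.
-- Also (α - β)² = P² + 12 ≡ 1, so for every k ≡ 1 (mod 3) the number
-- k (U_n + (α - β)²) + 1 ≡ 2k + 1 ≡ 0 (mod 3), and it exceeds 3.
module Submission where

open import Defs
open import Data.Nat as ℕ using (ℕ; zero; suc; _%_; NonZero)
open import Data.Nat.DivMod using (%-distribˡ-+; %-distribˡ-*; [m+kn]%n≡m%n)
open import Data.Nat.Divisibility
  using (_∣_; ∣1⇒≡1; ∣m+n∣m⇒∣n; ∣n⇒∣m*n; m%n≡0⇒n∣m; hasNonTrivialDivisor)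
open import Data.Nat.GCD using (gcd[m,n]∣m; gcd[m,n]∣n) renaming (gcd to gcdℕ)
open import Data.Nat.Primality using (Composite)
import Data.Nat.Properties as ℕ
open import Data.Integer using (+_; _+_; _-_; _*_; -_; ∣_∣)
open import Data.Integer.Properties
  using (pos-+; pos-*; +-injective; neg-distribˡ-*; neg-distribʳ-*; neg-involutive)
open import Data.Product using (_×_; ∃-syntax; _,_)
open import Relation.Nullary using (¬_)
open import Relation.Binary.PropositionalEquality

lucas : ℕ → ℕ → ℕ → ℕ
lucas p q zero = 0
lucas p q (suc zero) = 1
lucas p q (suc (suc n)) = p ℕ.* lucas p q (suc n) ℕ.+ q ℕ.* lucas p q n

U-lucas : ∀ p q n → U (+ p) (- + q) n ≡ + lucas p q n
U-lucas p q zero = refl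
U-lucas p q (suc zero) = refl
U-lucas p q (suc (suc n)) = begin
  + p * U (+ p) (- + q) (suc n) - (- + q) * U (+ p) (- + q) n
    ≡⟨ cong₂ (λ x y → + p * x - (- + q) * y) (U-lucas p q (suc n)) (U-lucas p q n) ⟩
  + p * + u₁ + - (- + q * + u₀)
    ≡⟨ cong (λ x → + p * + u₁ + x) (neg-distribˡ-* (- + q) (+ u₀)) ⟩
  + p * + u₁ + - - + q * + u₀
    ≡⟨ cong (λ x → + p * + u₁ + x * + u₀) (neg-involutive (+ q)) ⟩
  + p * + u₁ + + q * + u₀
    ≡⟨ cong₂ _+_ (sym (pos-* p u₁)) (sym (pos-* q u₀)) ⟩
  + (p ℕ.* u₁) + + (q ℕ.* u₀)
    ≡⟨ sym (pos-+ (p ℕ.* u₁) (q ℕ.* u₀)) ⟩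
  + lucas p q (suc (suc n)) ∎
  where
  open ≡-Reasoning
  u₀ u₁ : ℕ
  u₀ = lucas p q n
  u₁ = lucas p q (suc n)

Disc-lucas : ∀ p q → Disc (+ p) (- + q) ≡ + (p ℕ.* p ℕ.+ 4 ℕ.* q)
Disc-lucas p q = begin
  + p * + p + - (+ 4 * - + q)  ≡⟨ cong (λ x → + p * + p + x) (neg-distribʳ-* (+ 4) (- + q)) ⟩
  + p * + p + + 4 * - - + q    ≡⟨ cong (λ x → + p * + p + + 4 * x) (neg-involutive (+ q)) ⟩
  + p * + p + + 4 * + q        ≡⟨ cong₂ _+_ (sym (pos-* p p)) (sym (pos-* 4 q)) ⟩
  + (p ℕ.* p) + + (4 ℕ.* q)    ≡⟨ sym (pos-+ (p ℕ.* p) (4 ℕ.* q)) ⟩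
  + (p ℕ.* p ℕ.+ 4 ℕ.* q)      ∎
  where open ≡-Reasoning

lucas-≤-suc : ∀ p q n → lucas (suc p) q n ℕ.≤ lucas (suc p) q (suc n)
lucas-≤-suc p q zero = ℕ.z≤n
lucas-≤-suc p q (suc n) = ℕ.≤-trans (ℕ.m≤n*m u₁ (suc p)) (ℕ.m≤m+n (suc p ℕ.* u₁) _)
  where u₁ = lucas (suc p) q (suc n)

lucas-positive : ∀ p q n → 0 ℕ.< lucas (suc p) q (suc n)
lucas-positive p q zero = ℕ.s≤s ℕ.z≤n
lucas-positive p q (suc n) = ℕ.<-≤-trans (lucas-positive p q n) (lucas-≤-suc p q (suc n))

¬RatioRootOfUnity-pos-neg : ∀ p q → ¬ RatioRootOfUnity (+ suc p) (- + q)
¬RatioRootOfUnity-pos-neg p q (suc m , _ , Disc*U²≡0) =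
  ℕ.≢-nonZero⁻¹ (d ℕ.* (u ℕ.* u)) {{ℕ.m*n≢0 d (u ℕ.* u) {{_}} {{ℕ.m*n≢0 u u}}}} (+-injective (begin
    + (d ℕ.* (u ℕ.* u))                       ≡⟨ pos-* d (u ℕ.* u) ⟩
    + d * + (u ℕ.* u)                         ≡⟨ cong (+ d *_) (pos-* u u) ⟩
    + d * (+ u * + u)                         ≡⟨ sym (cong₂ (λ x y → x * (y * y)) (Disc-lucas (suc p) q) (U-lucas (suc p) q (suc m))) ⟩
    Disc (+ suc p) (- + q) * (U (+ suc p) (- + q) (suc m) * U (+ suc p) (- + q) (suc m))
                                              ≡⟨ Disc*U²≡0 ⟩
    + 0                                       ∎))
  where
  open ≡-Reasoning
  d u : ℕ
  d = suc p ℕ.* suc p ℕ.+ 4 ℕ.* q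
  u = lucas (suc p) q (suc m)
  instance
    u≢0 : NonZero u
    u≢0 = ℕ.>-nonZero (lucas-positive p q m)

lucas%3≡1 : ∀ {p q} → p % 3 ≡ 1 → q % 3 ≡ 0 → ∀ n → lucas p q (suc n) % 3 ≡ 1
lucas%3≡1 p%3≡1 q%3≡0 zero = refl
lucas%3≡1 {p} {q} p%3≡1 q%3≡0 (suc n) = begin
  (p ℕ.* u₁ ℕ.+ q ℕ.* u₀) % 3
    ≡⟨ %-distribˡ-+ (p ℕ.* u₁) (q ℕ.* u₀) 3 ⟩
  ((p ℕ.* u₁) % 3 ℕ.+ (q ℕ.* u₀) % 3) % 3
    ≡⟨ cong₂ (λ x y → (x ℕ.+ y) % 3) (%-distribˡ-* p u₁ 3) (%-distribˡ-* q u₀ 3) ⟩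
  ((p % 3 ℕ.* (u₁ % 3)) % 3 ℕ.+ (q % 3 ℕ.* (u₀ % 3)) % 3) % 3
    ≡⟨ cong₂ (λ x y → ((x ℕ.* y) % 3 ℕ.+ (q % 3 ℕ.* (u₀ % 3)) % 3) % 3) p%3≡1 (lucas%3≡1 p%3≡1 q%3≡0 n) ⟩
  (1 ℕ.+ (q % 3 ℕ.* (u₀ % 3)) % 3) % 3
    ≡⟨ cong (λ x → (1 ℕ.+ (x ℕ.* (u₀ % 3)) % 3) % 3) q%3≡0 ⟩
  1 ∎
  where
  open ≡-Reasoning
  u₀ u₁ : ℕ
  u₀ = lucas p q n
  u₁ = lucas p q (suc n)

3∣k[m+n]+1 : ∀ {k m n} → k % 3 ≡ 1 → m % 3 ≡ 1 → n % 3 ≡ 1 → 3 ∣ k ℕ.* (m ℕ.+ n) ℕ.+ 1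
3∣k[m+n]+1 {k} {m} {n} k%3≡1 m%3≡1 n%3≡1 = m%n≡0⇒n∣m _ 3 (begin
  (k ℕ.* (m ℕ.+ n) ℕ.+ 1) % 3
    ≡⟨ %-distribˡ-+ (k ℕ.* (m ℕ.+ n)) 1 3 ⟩
  ((k ℕ.* (m ℕ.+ n)) % 3 ℕ.+ 1) % 3
    ≡⟨ cong (λ x → (x ℕ.+ 1) % 3) (%-distribˡ-* k (m ℕ.+ n) 3) ⟩
  ((k % 3 ℕ.* ((m ℕ.+ n) % 3)) % 3 ℕ.+ 1) % 3
    ≡⟨ cong (λ x → ((k % 3 ℕ.* x) % 3 ℕ.+ 1) % 3) (%-distribˡ-+ m n 3) ⟩
  ((k % 3 ℕ.* ((m % 3 ℕ.+ n % 3) % 3)) % 3 ℕ.+ 1) % 3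
    ≡⟨ cong₂ (λ x y → ((x ℕ.* ((y ℕ.+ n % 3) % 3)) % 3 ℕ.+ 1) % 3) k%3≡1 m%3≡1 ⟩
  ((1 ℕ.* ((1 ℕ.+ n % 3) % 3)) % 3 ℕ.+ 1) % 3
    ≡⟨ cong (λ x → ((1 ℕ.* ((1 ℕ.+ x) % 3)) % 3 ℕ.+ 1) % 3) n%3≡1 ⟩
  0 ∎)
  where open ≡-Reasoning

composite-k[m+n]+1 : ∀ k m n → k % 3 ≡ 1 → m % 3 ≡ 1 → n % 3 ≡ 1 → 3 ℕ.≤ n →
                     Composite (k ℕ.* (m ℕ.+ n) ℕ.+ 1)
composite-k[m+n]+1 zero m n () _ _ _
composite-k[m+n]+1 k@(suc _) m n k%3≡1 m%3≡1 n%3≡1 3≤n =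
  hasNonTrivialDivisor (ℕ.+-monoˡ-≤ 1 3≤k[m+n]) (3∣k[m+n]+1 {k} {m} {n} k%3≡1 m%3≡1 n%3≡1)
  where
  3≤k[m+n] : 3 ℕ.≤ k ℕ.* (m ℕ.+ n)
  3≤k[m+n] = ℕ.≤-trans (ℕ.m≤n⇒m≤o+n m 3≤n) (ℕ.m≤n*m (m ℕ.+ n) k)

gcd[1+kn,n]≡1 : ∀ k n → gcdℕ (suc (k ℕ.* n)) n ≡ 1
gcd[1+kn,n]≡1 k n = ∣1⇒≡1 (∣m+n∣m⇒∣n g∣kn+1 (∣n⇒∣m*n k (gcd[m,n]∣n (suc (k ℕ.* n)) n)))
  where
  g∣kn+1 : gcdℕ (suc (k ℕ.* n)) n ∣ k ℕ.* n ℕ.+ 1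
  g∣kn+1 = subst (gcdℕ (suc (k ℕ.* n)) n ∣_) (ℕ.+-comm 1 (k ℕ.* n)) (gcd[m,n]∣m (suc (k ℕ.* n)) n)

pos-k*[m+n]+1 : ∀ k m n → + k * (+ m + + n) + + 1 ≡ + (k ℕ.* (m ℕ.+ n) ℕ.+ 1)
pos-k*[m+n]+1 k m n = begin
  + k * (+ m + + n) + + 1       ≡⟨ cong (λ x → + k * x + + 1) (sym (pos-+ m n)) ⟩
  + k * + (m ℕ.+ n) + + 1       ≡⟨ cong (_+ + 1) (sym (pos-* k (m ℕ.+ n))) ⟩
  + (k ℕ.* (m ℕ.+ n)) + + 1     ≡⟨ sym (pos-+ (k ℕ.* (m ℕ.+ n)) 1) ⟩
  + (k ℕ.* (m ℕ.+ n) ℕ.+ 1)     ∎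
  where open ≡-Reasoning

isComposite-k[U+Disc]+1 : ∀ p k → p % 3 ≡ 1 → k % 3 ≡ 1 → ∀ n →
                          IsComposite (+ k * (U (+ p) (- + 3) (suc n) + Disc (+ p) (- + 3)) + + 1)
isComposite-k[U+Disc]+1 p k p%3≡1 k%3≡1 n =
  k ℕ.* (u ℕ.+ d) ℕ.+ 1 ,
  trans (cong₂ (λ x y → + k * (x + y) + + 1) (U-lucas p 3 (suc n)) (Disc-lucas p 3))
        (pos-k*[m+n]+1 k u d) ,
  composite-k[m+n]+1 k u d k%3≡1 (lucas%3≡1 p%3≡1 refl n) d%3≡1 3≤d
  where
  u d : ℕ
  u = lucas p 3 (suc n)
  d = p ℕ.* p ℕ.+ 4 ℕ.* 3
  d%3≡1 : d % 3 ≡ 1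
  d%3≡1 = trans ([m+kn]%n≡m%n (p ℕ.* p) 4 3) (trans (%-distribˡ-* p p 3) (cong (λ x → (x ℕ.* x) % 3) p%3≡1))
  3≤d : 3 ℕ.≤ d
  3≤d = ℕ.≤-trans (ℕ.m≤m+n 3 9) (ℕ.m≤n+m 12 (p ℕ.* p))

theorem3p1 : ∀ (N : ℕ) → ∃[ P ] ∃[ Q ]
                 ( N ℕ.≤ ∣ P ∣ ℕ.+ ∣ Q ∣
                 × IsLucasPair P Q
                 × ¬ IsTrivialForm P Q
                 × (∀ (K : ℕ) → ∃[ k ] ( K ℕ.< k
                      × (∀ (n : ℕ) → 1 ℕ.≤ n →
                           IsComposite (+ k * (U P Q n + Disc P Q) + + 1)))))
theorem3p1 N =
  + p , - + 3 , N≤p+3 ,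
  ((λ ()) , (λ ()) , cong +_ (gcd[1+kn,n]≡1 N 3) , ¬RatioRootOfUnity-pos-neg (N ℕ.* 3) 3) ,
  (λ { (_ , _ , _ , ()) }) ,
  λ K → suc (K ℕ.* 3) , ℕ.s≤s (ℕ.m≤m*n K 3) , λ where
    (suc n) _ → isComposite-k[U+Disc]+1 p (suc (K ℕ.* 3)) ([m+kn]%n≡m%n 1 N 3) ([m+kn]%n≡m%n 1 K 3) n
  where
  p : ℕ
  p = suc (N ℕ.* 3)
  N≤p+3 : N ℕ.≤ p ℕ.+ 3
  N≤p+3 = ℕ.≤-trans (ℕ.m≤m*n N 3) (ℕ.≤-trans (ℕ.n≤1+n _) (ℕ.m≤m+n p 3))
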